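{- For any rational $q$ and any odd prime $p\notin\mathcal D(q)$: $C_p(q)\equiv q\pmod p$, $V_p(q)\equiv(q+2|p)\pmod p$, $W_p(q)\equiv(q-2|p)\pmod p$, and $U_p(q)\equiv(q^2-4|p)\pmod p$.
   Context: Chebyshev polynomials: $U_0=0$, $U_1=1$, $U_{n+1}=qU_n-U_{n-1}$; $C_n=U_{n+1}-U_{n-1}$; for odd $n=2k+1$, $V_n=U_{k+1}-U_k$, $W_n=U_{k+1}+U_k$. For a rational $q=a/b$ in lowest terms, $\mathcal D(q)$ is the set of prime divisors of $b$, and congruences mod $p\nmid b$ are taken in $\mathbb F_p$. Legendre symbol of a rational $x=a/b$ (lowest terms) at an odd prime $p\nmid b$: $(x|p)=1$ if $ab$ is a nonzero quadratic residue mod $p$, $-1$ if a nonresidue, $0$ if $p\mid a$. -}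

module Defs where

open import Data.Nat as ℕ using (ℕ; zero; suc)
open import Data.Nat.Divisibility using (_∣_; _∣?_)
open import Data.Integer as ℤ using (ℤ; +_; -[1+_])
open import Data.Rational using (ℚ; _+_; _-_; _*_; _/_; 0ℚ; 1ℚ; ↥_; ↧ₙ_)
open import Data.Fin using (Fin; toℕ)
open import Data.Fin.Properties using (any?)
open import Data.Product using (∃)
open import Relation.Nullary using (Dec; yes; no; ¬_)

U : ℕ → ℚ → ℚ
U zero q = 0ℚ
U (suc zero) q = 1ℚ
U (suc (suc n)) q = q * U (suc n) q - U n q

-- C_n = U_{n+1} − U_{n−1}  (C₀ := 2, using U_{−1} = −1; only n ≥ 1 is used)
C : ℕ → ℚ → ℚ
C zero q = (+ 2) / 1
C (suc n) q = U (suc (suc n)) q - U n q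

-- For odd n = 2k+1 (so k = ⌊n/2⌋): V_n = U_{k+1} − U_k, W_n = U_{k+1} + U_k
V : ℕ → ℚ → ℚ
V n q = U (suc (n ℕ./ 2)) q - U (n ℕ./ 2) q

W : ℕ → ℚ → ℚ
W n q = U (suc (n ℕ./ 2)) q + U (n ℕ./ 2) q

_∈𝒟_ : ℕ → ℚ → Set
p ∈𝒟 q = p ∣ ↧ₙ q

-- congruence of rationals modulo p (for p not dividing the denominators):
-- x ≡ y in 𝔽_p  iff  p divides the numerator of x − y
_≡_[mod_] : ℚ → ℚ → ℕ → Set
x ≡ y [mod p ] = p ∣ ℤ.∣ ↥ (x - y) ∣

legendre : ℚ → ℕ → ℤ
legendre x p with p ∣? ℤ.∣ ↥ x ∣
... | yes _ = + 0
... | no _ with any? {n = p} (λ (t : Fin p) →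
                p ∣? ℤ.∣ (+ toℕ t) ℤ.* (+ toℕ t) ℤ.- (↥ x) ℤ.* (+ (↧ₙ x)) ∣)
...   | yes _ = + 1
...   | no _ = -[1+ 0 ]

legendreℚ : ℚ → ℕ → ℚ
legendreℚ x p = legendre x p / 1

-- Choose an integer z with q ≡ z (mod p); then U_n(q) ≡ u_n(z) for the integer Chebyshev
-- sequence u. In ℤ[α] = ℤ[x]/(x² − zx + 1) the powers of α and of its inverse ᾱ = z − α have
-- the u_n as coordinates, and (α ± 1)² = (z ± 2)α. Writing p = 2k + 1, the congruence
-- (x + y)^p ≡ x^p + y^p applied to α + ᾱ = z gives u_{p+1} − u_{p−1} ≡ z^p ≡ z, and applied to
-- α ± 1, after multiplying by ᾱ^k, gives u_{k+1} ∓ u_k ≡ (z ± 2)^k. The addition formula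
-- u_{2k+1} = u_{k+1}² − u_k² turns the product of the last two into u_p ≡ (z² − 4)^k, and
-- Euler's criterion identifies these k-th powers with Legendre symbols.
module Submission where

open import Algebra.Bundles using (Semiring; CommutativeSemiring)
open import Data.Fin as Fin using (Fin; toℕ; inject₁; fromℕ; fromℕ<)
open import Data.Fin.Properties using (toℕ-inject₁; toℕ-fromℕ; toℕ<n; toℕ-fromℕ<; any?)
open import Data.Integer using (ℤ; +_; 0ℤ; 1ℤ; -1ℤ; ∣_∣)
import Data.Integer as ℤ
import Data.Integer.Properties as ℤₚ
open import Data.Integer.Divisibility.Signed as ℤ∣ using (divides; ∣ᵤ⇒∣; ∣⇒∣ᵤ)
open import Data.Integer.DivMod using (_%ℕ_; _/ℕ_; a≡a%ℕn+[a/ℕn]*n; n%ℕd<d)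
open import Data.Integer.Tactic.RingSolver using (solve-∀)
open import Data.Nat as ℕ using (ℕ; zero; suc; _∸_; _!; _<_; _≤_; z≤n; s≤s; nonTrivial⇒≢1; nonTrivial⇒n>1)
import Data.Nat.Properties as ℕₚ
open import Data.Nat.Combinatorics using (nCn≡1; k![n∸k]!∣n!) renaming (_C_ to _choose_)
open import Data.Nat.Combinatorics.Specification using (nCk≡n!/k![n-k]!)
open import Data.Nat.Coprimality using (recompute)
open import Data.Nat.Divisibility using (_∣_; _∤_; _∣?_; ∣1⇒≡1; ∣⇒≤; m∣m*n)
import Data.Nat.Divisibility as ℕ∣
open import Data.Nat.DivMod using (m/n*n≡m; m%n<n; m≡m%n+[m/n]*n)
open import Data.Nat.Primality using (Prime; euclidsLemma; prime⇒nonZero; prime⇒nonTrivial; prime⇒irreducible)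
open import Data.Product using (_,_; ∃-syntax; proj₁; proj₂)
open import Data.Rational using (ℚ; mkℚ; ↥_; ↧_; ↧ₙ_; toℚᵘ)
import Data.Rational as ℚ
open import Data.Rational.Properties using (toℚᵘ-homo-+; toℚᵘ-homo-*; toℚᵘ-fromℚᵘ; ↥-neg; ↧-neg)
open import Data.Rational.Unnormalised using (mkℚᵘ; *≡*)
import Data.Rational.Unnormalised as ℚᵘ
open import Data.Sum as Sum using (_⊎_; inj₁; inj₂; [_,_]′)
open import Data.Vec using (Vec; []; _∷_)
open import Data.Vec.Relation.Unary.All as All using (All; []; _∷_)
open import Data.Vec.Relation.Unary.AllPairs using (AllPairs; []; _∷_)
open import Function using (id; _∘_)
open import Level using (0ℓ)
open import Relation.Binary.Bundles using (Setoid)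
open import Relation.Binary.PropositionalEquality as ≡ using (_≡_; _≢_)
open import Relation.Nullary using (¬_; yes; no; contradiction)
open import Defs

prime⇒≢1 : ∀ {p} → Prime p → p ≢ 1
prime⇒≢1 p-prime = nonTrivial⇒≢1 {{prime⇒nonTrivial p-prime}}

prime∤! : ∀ {p m} → Prime p → m < p → p ∤ m !
prime∤! {m = zero}  p-prime _   p∣1   = prime⇒≢1 p-prime (∣1⇒≡1 p∣1)
prime∤! {m = suc m} p-prime m<p p∣[1+m]! with euclidsLemma (suc m) (m !) p-prime p∣[1+m]!
... | inj₁ p∣1+m = ℕₚ.<⇒≱ m<p (∣⇒≤ p∣1+m)
... | inj₂ p∣m!  = prime∤! p-prime (ℕₚ.<-trans (ℕₚ.n<1+n m) m<p) p∣m!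

p∣pCk : ∀ {p k} → Prime p → 0 < k → k < p → p ∣ p choose k
p∣pCk {suc n} {k} p-prime 0<k k<p with euclidsLemma (suc n choose k) (k ! ℕ.* (suc n ∸ k) !) p-prime p∣pCk*k![p∸k]!
  where
  instance
    k!*[p∸k]!≢0 : ℕ.NonZero (k ! ℕ.* (suc n ∸ k) !)
    k!*[p∸k]!≢0 = k ℕₚ.!* (suc n ∸ k) !≢0
  pCk*k![p∸k]!≡p! : (suc n choose k) ℕ.* (k ! ℕ.* (suc n ∸ k) !) ≡ suc n !
  pCk*k![p∸k]!≡p! = ≡.trans (≡.cong (ℕ._* (k ! ℕ.* (suc n ∸ k) !)) (nCk≡n!/k![n-k]! (ℕₚ.<⇒≤ k<p)))
                            (m/n*n≡m (k![n∸k]!∣n! (ℕₚ.<⇒≤ k<p)))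
  p∣pCk*k![p∸k]! : suc n ∣ (suc n choose k) ℕ.* (k ! ℕ.* (suc n ∸ k) !)
  p∣pCk*k![p∸k]! = ≡.subst (suc n ∣_) (≡.sym pCk*k![p∸k]!≡p!) (m∣m*n (n !))
... | inj₁ p∣pCk         = p∣pCk
... | inj₂ p∣k![p∸k]! with euclidsLemma (k !) ((suc n ∸ k) !) p-prime p∣k![p∸k]!
...   | inj₁ p∣k!     = contradiction p∣k! (prime∤! p-prime k<p)
...   | inj₂ p∣[p∸k]! = contradiction p∣[p∸k]! (prime∤! p-prime (ℕₚ.∸-monoʳ-< 0<k (ℕₚ.<⇒≤ k<p)))

module _ {c ℓ} (S : Semiring c ℓ) where
  open Semiring S
  open import Algebra.Properties.Semiring.Exp S using (_^_)
  open import Algebra.Properties.Semiring.Mult S using (_×_; ×-assocˡ)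
  open import Algebra.Properties.CommutativeMonoid.Mult +-commutativeMonoid using (×-distrib-+)
  open import Algebra.Properties.Monoid.Sum +-monoid using (sum; sum-init-last; sum-replicate; sum-replicate-zero)
  open import Algebra.Properties.CommutativeSemigroup +-commutativeSemigroup using (x∙yz≈zx∙y)
  import Algebra.Properties.Semiring.Binomial S as Binomial
  open import Relation.Binary.Reasoning.Setoid setoid

  sum-of-multiples : ∀ {m} n (f : Fin m → Carrier) → (∀ i → ∃[ w ] f i ≈ n × w) → ∃[ w ] sum f ≈ n × w
  sum-of-multiples {zero}  n f _ = 0# , sym (trans (sym (sum-replicate n)) (sum-replicate-zero n))
  sum-of-multiples {suc m} n f fᵢ≈n×wᵢ
    with fᵢ≈n×wᵢ Fin.zero | sum-of-multiples n (f ∘ Fin.suc) (fᵢ≈n×wᵢ ∘ Fin.suc)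
  ... | w₀ , f₀≈n×w₀ | w , ∑f≈n×w = w₀ + w , (begin
    f Fin.zero + sum (f ∘ Fin.suc)  ≈⟨ +-cong f₀≈n×w₀ ∑f≈n×w ⟩
    n × w₀ + n × w                  ≈⟨ ×-distrib-+ w₀ w n ⟨
    n × (w₀ + w)                    ∎)

  frobenius : ∀ {p} → Prime p → ∀ x y → x * y ≈ y * x → ∃[ w ] (x + y) ^ p ≈ x ^ p + y ^ p + p × w
  frobenius {suc n} p-prime x y xy≈yx = w , (begin
    (x + y) ^ p                                               ≈⟨ theorem xy≈yx p ⟩
    binomialExpansion p                                       ≈⟨ +-congˡ (sum-init-last (term ∘ Fin.suc)) ⟩
    term Fin.zero + (sum middle + term (Fin.suc (fromℕ n)))   ≈⟨ +-cong first≈y^p (+-cong ∑middle≈p×w last≈x^p) ⟩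
    y ^ p + (p × w + x ^ p)                                   ≈⟨ x∙yz≈zx∙y _ _ _ ⟩
    x ^ p + y ^ p + p × w                                     ∎)
    where
    open Binomial x y using (theorem; binomialTerm; binomialExpansion)
    p : ℕ
    p = suc n
    term : Fin (suc p) → Carrier
    term = binomialTerm p
    middle : Fin n → Carrier
    middle i = term (Fin.suc (inject₁ i))

    first≈y^p : term Fin.zero ≈ y ^ p
    first≈y^p = trans (+-identityʳ _) (*-identityˡ _)

    last≈x^p : term (Fin.suc (fromℕ n)) ≈ x ^ p
    last≈x^p = begin
      (p choose suc (toℕ (fromℕ n))) × (x ^ suc (toℕ (fromℕ n)) * y ^ (n ∸ toℕ (fromℕ n)))
        ≡⟨ ≡.cong (λ j → (p choose suc j) × (x ^ suc j * y ^ (n ∸ j))) (toℕ-fromℕ n) ⟩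
      (p choose p) × (x ^ p * y ^ (n ∸ n))
        ≡⟨ ≡.cong₂ (λ c j → c × (x ^ p * y ^ j)) (nCn≡1 p) (ℕₚ.n∸n≡0 n) ⟩
      x ^ p * 1# + 0#
        ≈⟨ trans (+-identityʳ _) (*-identityʳ _) ⟩
      x ^ p ∎

    middle-multiple : ∀ i → ∃[ w ] middle i ≈ p × w
    middle-multiple i with p∣pCk p-prime (s≤s z≤n) (s≤s (≡.subst (_< n) (≡.sym (toℕ-inject₁ i)) (toℕ<n i)))
    ... | ℕ∣.divides q pCk≡q*p = q × b , (begin
      (p choose k) × b       ≡⟨ ≡.cong (_× b) (≡.trans pCk≡q*p (ℕₚ.*-comm q p)) ⟩
      (p ℕ.* q) × b     ≈⟨ ×-assocˡ b p q ⟨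
      p × (q × b)       ∎)
      where
      k : ℕ
      k = suc (toℕ (inject₁ i))
      b : Carrier
      b = x ^ k * y ^ (n ∸ toℕ (inject₁ i))

    w : Carrier
    w = proj₁ (sum-of-multiples p middle middle-multiple)
    ∑middle≈p×w : sum middle ≈ p × w
    ∑middle≈p×w = proj₂ (sum-of-multiples p middle middle-multiple)

module _ {c ℓ} (S : CommutativeSemiring c ℓ) where
  open CommutativeSemiring S
  open import Algebra.Properties.CommutativeSemiring.Exp S using (_^_; ^-distrib-*; ^-homo-*; ^-congˡ; ^-congʳ)
  open import Algebra.Properties.CommutativeSemigroup *-commutativeSemigroup using (x∙yz≈y∙xz)
  open import Relation.Binary.Reasoning.Setoid setoid

  1#^n≈1# : ∀ n → 1# ^ n ≈ 1#
  1#^n≈1# zero    = refl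
  1#^n≈1# (suc n) = trans (*-identityˡ _) (1#^n≈1# n)

  v^n*w^n≈1# : ∀ {v w} n → v * w ≈ 1# → v ^ n * w ^ n ≈ 1#
  v^n*w^n≈1# {v} {w} n vw≈1 = begin
    v ^ n * w ^ n   ≈⟨ ^-distrib-* v w n ⟨
    (v * w) ^ n     ≈⟨ ^-congˡ n vw≈1 ⟩
    1# ^ n          ≈⟨ 1#^n≈1# n ⟩
    1#              ∎

  x^[1+n+n]≈x*y^n : ∀ {x y} n → x * x ≈ y → x ^ suc (n ℕ.+ n) ≈ x * y ^ n
  x^[1+n+n]≈x*y^n {x} {y} n xx≈y = *-congˡ (begin
    x ^ (n ℕ.+ n)   ≈⟨ ^-homo-* x n n ⟩
    x ^ n * x ^ n   ≈⟨ ^-distrib-* x x n ⟨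
    (x * x) ^ n     ≈⟨ ^-congˡ n xx≈y ⟩
    y ^ n           ∎)

  v^n*x^[1+n+n]≈x*y^n : ∀ {v w x y} n → v * w ≈ 1# → x * x ≈ y * w → v ^ n * x ^ suc (n ℕ.+ n) ≈ x * y ^ n
  v^n*x^[1+n+n]≈x*y^n {v} {w} {x} {y} n vw≈1 xx≈yw = begin
    v ^ n * x ^ suc (n ℕ.+ n)        ≈⟨ *-congˡ (x^[1+n+n]≈x*y^n n xx≈yw) ⟩
    v ^ n * (x * (y * w) ^ n)        ≈⟨ *-congˡ (*-congˡ (^-distrib-* y w n)) ⟩
    v ^ n * (x * (y ^ n * w ^ n))    ≈⟨ *-congˡ (*-assoc x _ _) ⟨
    v ^ n * (x * y ^ n * w ^ n)      ≈⟨ x∙yz≈y∙xz _ _ _ ⟩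
    x * y ^ n * (v ^ n * w ^ n)      ≈⟨ *-congˡ (v^n*w^n≈1# n vw≈1) ⟩
    x * y ^ n * 1#                   ≈⟨ *-identityʳ _ ⟩
    x * y ^ n                        ∎

  v^n*[w^[1+n+n]+c]≈w^[1+n]+c*v^n : ∀ {v w} n c → v * w ≈ 1# →
                                    v ^ n * (w ^ suc (n ℕ.+ n) + c) ≈ w ^ suc n + c * v ^ n
  v^n*[w^[1+n+n]+c]≈w^[1+n]+c*v^n {v} {w} n c vw≈1 = begin
    v ^ n * (w ^ suc (n ℕ.+ n) + c)          ≈⟨ distribˡ _ _ _ ⟩
    v ^ n * w ^ suc (n ℕ.+ n) + v ^ n * c    ≈⟨ +-cong (*-congˡ (^-congʳ w (ℕₚ.+-suc n n))) (*-comm _ _) ⟨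
    v ^ n * w ^ (n ℕ.+ suc n) + c * v ^ n    ≈⟨ +-congʳ (*-congˡ (^-homo-* w n (suc n))) ⟩
    v ^ n * (w ^ n * w ^ suc n) + c * v ^ n  ≈⟨ +-congʳ (*-assoc _ _ _) ⟨
    v ^ n * w ^ n * w ^ suc n + c * v ^ n    ≈⟨ +-congʳ (*-congʳ (v^n*w^n≈1# n vw≈1)) ⟩
    1# * w ^ suc n + c * v ^ n               ≈⟨ +-congʳ (*-identityˡ _) ⟩
    w ^ suc n + c * v ^ n                    ∎

^-distribʳ-* : ∀ a b n → (a ℤ.* b) ℤ.^ n ≡ a ℤ.^ n ℤ.* b ℤ.^ n
^-distribʳ-* a b zero    = ≡.refl
^-distribʳ-* a b (suc n) = ≡.trans (≡.cong (a ℤ.* b ℤ.*_) (^-distribʳ-* a b n)) (interchange a b (a ℤ.^ n) (b ℤ.^ n))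
  where
  interchange : ∀ a b c d → a ℤ.* b ℤ.* (c ℤ.* d) ≡ a ℤ.* c ℤ.* (b ℤ.* d)
  interchange = solve-∀

-- Polynomials over ℤ as coefficient vectors, constant term first.
module Polynomial where
  open import Data.Integer using (_+_; _*_; _-_; _^_)
  open ≡.≡-Reasoning

  eval : ∀ {n} → Vec ℤ n → ℤ → ℤ
  eval []      x = 0ℤ
  eval (a ∷ f) x = a + x * eval f x

  quotient : ∀ {n} → Vec ℤ (suc n) → ℤ → Vec ℤ n
  quotient (_ ∷ [])        r = []
  quotient (_ ∷ f@(_ ∷ _)) r = eval f r ∷ quotient f r

  factor-theorem : ∀ {n} (f : Vec ℤ (suc n)) x r → eval f x - eval f r ≡ (x - r) * eval (quotient f r) x
  factor-theorem (a ∷ [])        x r = constant a x r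
    where
    constant : ∀ a x r → (a + x * 0ℤ) - (a + r * 0ℤ) ≡ (x - r) * 0ℤ
    constant = solve-∀
  factor-theorem (a ∷ f@(_ ∷ _)) x r = begin
    (a + x * eval f x) - (a + r * eval f r)         ≡⟨ split a x r (eval f x) (eval f r) ⟩
    (x - r) * eval f r + x * (eval f x - eval f r)  ≡⟨ ≡.cong (λ d → (x - r) * eval f r + x * d) (factor-theorem f x r) ⟩
    (x - r) * eval f r + x * ((x - r) * q)          ≡⟨ collect x r (eval f r) q ⟩
    (x - r) * (eval f r + x * q)                    ∎
    where
    q : ℤ
    q = eval (quotient f r) x
    split : ∀ a x r u v → (a + x * u) - (a + r * v) ≡ (x - r) * v + x * (u - v)
    split = solve-∀
    collect : ∀ x r v q → (x - r) * v + x * ((x - r) * q) ≡ (x - r) * (v + x * q)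
    collect = solve-∀

  monomial : ∀ k → Vec ℤ (suc k)
  monomial zero    = 1ℤ ∷ []
  monomial (suc k) = 0ℤ ∷ monomial k

  eval-monomial : ∀ k x → eval (monomial k) x ≡ x ^ k
  eval-monomial zero    x = ≡.cong (λ t → 1ℤ + t) (ℤₚ.*-zeroʳ x)
  eval-monomial (suc k) x = ≡.trans (ℤₚ.+-identityˡ _) (≡.cong (x *_) (eval-monomial k x))

  xᵏ-1 : ∀ k → Vec ℤ (suc k)
  xᵏ-1 zero    = 0ℤ ∷ []
  xᵏ-1 (suc k) = -1ℤ ∷ monomial k

  eval-xᵏ-1 : ∀ k x → eval (xᵏ-1 k) x ≡ x ^ k - 1ℤ
  eval-xᵏ-1 zero    x = ≡.cong (λ t → 0ℤ + t) (ℤₚ.*-zeroʳ x)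
  eval-xᵏ-1 (suc k) x = begin
    -1ℤ + x * eval (monomial k) x   ≡⟨ ≡.cong (λ m → -1ℤ + x * m) (eval-monomial k x) ⟩
    -1ℤ + x * x ^ k                 ≡⟨ ℤₚ.+-comm -1ℤ (x * x ^ k) ⟩
    x * x ^ k - 1ℤ                  ∎

module Modulo (p : ℕ) where
  open import Data.Integer using (_+_; _*_; _-_; -_; _^_)
  open Polynomial

  infix 4 _≈_ _≉_
  record _≈_ (a b : ℤ) : Set where
    constructor mk≈
    field p∣a-b : + p ℤ∣.∣ a - b

  _≉_ : ℤ → ℤ → Set
  a ≉ b = ¬ a ≈ b

  private
    by : ∀ {a b x} → x ≡ a - b → + p ℤ∣.∣ x → a ≈ b
    by x≡a-b p∣x = mk≈ (≡.subst (+ p ℤ∣.∣_) x≡a-b p∣x)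

  ≈-refl : ∀ {a} → a ≈ a
  ≈-refl {a} = mk≈ (divides 0ℤ (ℤₚ.+-inverseʳ a))

  ≈-reflexive : ∀ {a b} → a ≡ b → a ≈ b
  ≈-reflexive ≡.refl = ≈-refl

  ≈-sym : ∀ {a b} → a ≈ b → b ≈ a
  ≈-sym {a} {b} (mk≈ p∣a-b) = by (flip a b) (ℤ∣.∣m⇒∣-m p∣a-b)
    where
    flip : ∀ a b → - (a - b) ≡ b - a
    flip = solve-∀

  ≈-trans : ∀ {a b c} → a ≈ b → b ≈ c → a ≈ c
  ≈-trans {a} {b} {c} (mk≈ p∣a-b) (mk≈ p∣b-c) = by (telescope a b c) (ℤ∣.∣m∣n⇒∣m+n p∣a-b p∣b-c)
    where
    telescope : ∀ a b c → (a - b) + (b - c) ≡ a - c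
    telescope = solve-∀

  ≈-setoid : Setoid 0ℓ 0ℓ
  ≈-setoid = record
    { Carrier = ℤ
    ; _≈_ = _≈_
    ; isEquivalence = record { refl = ≈-refl ; sym = ≈-sym ; trans = ≈-trans }
    }

  +-cong : ∀ {a b c d} → a ≈ b → c ≈ d → a + c ≈ b + d
  +-cong {a} {b} {c} {d} (mk≈ p∣a-b) (mk≈ p∣c-d) = by (regroup a b c d) (ℤ∣.∣m∣n⇒∣m+n p∣a-b p∣c-d)
    where
    regroup : ∀ a b c d → (a - b) + (c - d) ≡ (a + c) - (b + d)
    regroup = solve-∀

  neg-cong : ∀ {a b} → a ≈ b → - a ≈ - b
  neg-cong {a} {b} (mk≈ p∣a-b) = by (regroup a b) (ℤ∣.∣m⇒∣-m p∣a-b)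
    where
    regroup : ∀ a b → - (a - b) ≡ - a - - b
    regroup = solve-∀

  -‿cong : ∀ {a b c d} → a ≈ b → c ≈ d → a - c ≈ b - d
  -‿cong a≈b c≈d = +-cong a≈b (neg-cong c≈d)

  *-cong : ∀ {a b c d} → a ≈ b → c ≈ d → a * c ≈ b * d
  *-cong {a} {b} {c} {d} (mk≈ p∣a-b) (mk≈ p∣c-d) =
    by (regroup a b c d) (ℤ∣.∣m∣n⇒∣m+n (ℤ∣.∣m⇒∣m*n c p∣a-b) (ℤ∣.∣n⇒∣m*n b p∣c-d))
    where
    regroup : ∀ a b c d → (a - b) * c + b * (c - d) ≡ a * c - b * d
    regroup = solve-∀

  ^-cong : ∀ {a b} n → a ≈ b → a ^ n ≈ b ^ n
  ^-cong zero    _   = ≈-refl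
  ^-cong (suc n) a≈b = *-cong a≈b (^-cong n a≈b)

  multiple≈0 : ∀ a → + p * a ≈ 0ℤ
  multiple≈0 a = by (≡.sym (ℤₚ.+-identityʳ (+ p * a))) (ℤ∣.∣m⇒∣m*n a ℤ∣.∣-refl)

  ∣⇒≈0 : ∀ {a} → p ∣ ∣ a ∣ → a ≈ 0ℤ
  ∣⇒≈0 {a} p∣a = by (≡.sym (ℤₚ.+-identityʳ a)) (∣ᵤ⇒∣ p∣a)

  ≈0⇒∣ : ∀ {a} → a ≈ 0ℤ → p ∣ ∣ a ∣
  ≈0⇒∣ {a} (mk≈ p∣a-0) = ∣⇒∣ᵤ (≡.subst (+ p ℤ∣.∣_) (ℤₚ.+-identityʳ a) p∣a-0)

  ∤⇒≉0 : ∀ {n} → p ∤ n → + n ≉ 0ℤ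
  ∤⇒≉0 p∤n n≈0 = p∤n (≈0⇒∣ n≈0)

  ≈⇒-≈0 : ∀ {a b} → a ≈ b → a - b ≈ 0ℤ
  ≈⇒-≈0 {a} {b} (mk≈ p∣a-b) = by (≡.sym (ℤₚ.+-identityʳ (a - b))) p∣a-b

  -≈0⇒≈ : ∀ {a b} → a - b ≈ 0ℤ → a ≈ b
  -≈0⇒≈ {a} {b} (mk≈ p∣a-b-0) = mk≈ (≡.subst (+ p ℤ∣.∣_) (ℤₚ.+-identityʳ (a - b)) p∣a-b-0)

  ≈-%ℕ : ∀ a .{{_ : ℕ.NonZero p}} → a ≈ + (a %ℕ p)
  ≈-%ℕ a = by (≡.trans (cancel (+ p) r q) (≡.cong (_- r) (≡.sym (a≡a%ℕn+[a/ℕn]*n a p)))) (ℤ∣.∣m⇒∣m*n q ℤ∣.∣-refl)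
    where
    r q : ℤ
    r = + (a %ℕ p)
    q = a /ℕ p
    cancel : ∀ P r q → P * q ≡ (r + q * P) - r
    cancel = solve-∀

  module Field (p-prime : Prime p) where
    private instance
      p≢0 : ℕ.NonZero p
      p≢0 = prime⇒nonZero p-prime
    open import Relation.Binary.Reasoning.Setoid ≈-setoid

    ≈0-* : ∀ a b → a * b ≈ 0ℤ → a ≈ 0ℤ ⊎ b ≈ 0ℤ
    ≈0-* a b ab≈0 with euclidsLemma ∣ a ∣ ∣ b ∣ p-prime (≡.subst (p ∣_) (ℤₚ.abs-* a b) (≈0⇒∣ ab≈0))
    ... | inj₁ p∣a = inj₁ (∣⇒≈0 p∣a)
    ... | inj₂ p∣b = inj₂ (∣⇒≈0 p∣b)

    *-≉0 : ∀ {a b} → a ≉ 0ℤ → b ≉ 0ℤ → a * b ≉ 0ℤ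
    *-≉0 {a} {b} a≉0 b≉0 ab≈0 = [ a≉0 , b≉0 ]′ (≈0-* a b ab≈0)

    *-cancelʳ-≈ : ∀ {a b c} → c ≉ 0ℤ → a * c ≈ b * c → a ≈ b
    *-cancelʳ-≈ {a} {b} {c} c≉0 ac≈bc with ≈0-* (a - b) c (≈-trans (≈-reflexive (distrib a b c)) (≈⇒-≈0 ac≈bc))
      where
      distrib : ∀ a b c → (a - b) * c ≡ a * c - b * c
      distrib = solve-∀
    ... | inj₁ a-b≈0 = -≈0⇒≈ a-b≈0
    ... | inj₂ c≈0   = contradiction c≈0 c≉0

    +≉0 : ∀ {m} → 0 < m → m < p → + m ≉ 0ℤ
    +≉0 {m} 0<m m<p m≈0 = ℕₚ.<⇒≱ m<p (∣⇒≤ {{ℕ.>-nonZero 0<m}} (≈0⇒∣ m≈0))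

    1≉0 : 1ℤ ≉ 0ℤ
    1≉0 = +≉0 (s≤s z≤n) (nonTrivial⇒n>1 p {{prime⇒nonTrivial p-prime}})

    frobenius-ℤ : ∀ a b → (a + b) ^ p ≈ a ^ p + b ^ p
    frobenius-ℤ a b = begin
      (a + b) ^ p                     ≡⟨ ^ˢ≡^ (a + b) p ⟨
      (a + b) ^ˢ p                    ≡⟨ proj₂ expansion ⟩
      a ^ˢ p + b ^ˢ p + p ×ˢ w        ≈⟨ +-cong (≈-refl {a ^ˢ p + b ^ˢ p}) p×w≈0 ⟩
      a ^ˢ p + b ^ˢ p + 0ℤ            ≡⟨ ℤₚ.+-identityʳ _ ⟩
      a ^ˢ p + b ^ˢ p                 ≡⟨ ≡.cong₂ _+_ (^ˢ≡^ a p) (^ˢ≡^ b p) ⟩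
      a ^ p + b ^ p                   ∎
      where
      open import Algebra.Properties.Semiring.Exp ℤₚ.+-*-semiring using () renaming (_^_ to _^ˢ_)
      open import Algebra.Properties.Semiring.Mult ℤₚ.+-*-semiring using () renaming (_×_ to _×ˢ_)

      ^ˢ≡^ : ∀ a n → a ^ˢ n ≡ a ^ n
      ^ˢ≡^ a zero    = ≡.refl
      ^ˢ≡^ a (suc n) = ≡.cong (a *_) (^ˢ≡^ a n)

      ×ˢ≡* : ∀ n a → n ×ˢ a ≡ + n * a
      ×ˢ≡* zero    a = ≡.refl
      ×ˢ≡* (suc n) a = ≡.trans (≡.cong (λ t → a + t) (×ˢ≡* n a)) (≡.sym (ℤₚ.suc-* (+ n) a))

      expansion : ∃[ w ] (a + b) ^ˢ p ≡ a ^ˢ p + b ^ˢ p + p ×ˢ w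
      expansion = frobenius ℤₚ.+-*-semiring p-prime a b (ℤₚ.*-comm a b)
      w : ℤ
      w = proj₁ expansion
      p×w≈0 : p ×ˢ w ≈ 0ℤ
      p×w≈0 = ≈-trans (≈-reflexive (×ˢ≡* p w)) (multiple≈0 w)

    fermat : ∀ a → a ^ p ≈ a
    fermat a = begin
      a ^ p             ≈⟨ ^-cong p (≈-%ℕ a) ⟩
      (+ (a %ℕ p)) ^ p  ≈⟨ fermat-ℕ (a %ℕ p) ⟩
      + (a %ℕ p)        ≈⟨ ≈-%ℕ a ⟨
      a                 ∎
      where
      fermat-ℕ : ∀ n → (+ n) ^ p ≈ + n
      fermat-ℕ zero    = ≈-reflexive (≡.subst (λ e → 0ℤ ^ e ≡ 0ℤ) (ℕₚ.suc-pred p) ≡.refl)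
      fermat-ℕ (suc n) = ≈-trans (frobenius-ℤ (+ 1) (+ n)) (+-cong (≈-reflexive (ℤₚ.^-zeroˡ p)) (fermat-ℕ n))

    distinct-roots⇒≈0 : ∀ {n} (f rs : Vec ℤ n) → AllPairs _≉_ rs → All (λ r → eval f r ≈ 0ℤ) rs →
                        ∀ x → eval f x ≈ 0ℤ
    distinct-roots⇒≈0 [] [] _ _ x = ≈-refl
    distinct-roots⇒≈0 {suc n} f (r ∷ rs) (r≉rs ∷ rs-distinct) (fr≈0 ∷ frs≈0) x = begin
      eval f x                                    ≡⟨ split (eval f x) (eval f r) ⟩
      (eval f x - eval f r) + eval f r            ≡⟨ ≡.cong (_+ eval f r) (factor-theorem f x r) ⟩
      (x - r) * eval q x + eval f r               ≈⟨ +-cong (*-cong (≈-refl {x - r}) (q≈0 x)) fr≈0 ⟩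
      (x - r) * 0ℤ + 0ℤ                           ≡⟨ ≡.cong (_+ 0ℤ) (ℤₚ.*-zeroʳ (x - r)) ⟩
      0ℤ                                          ∎
      where
      q : Vec ℤ n
      q = quotient f r
      split : ∀ u v → u ≡ (u - v) + v
      split = solve-∀

      root-of-q : ∀ {s} → r ≉ s → eval f s ≈ 0ℤ → eval q s ≈ 0ℤ
      root-of-q {s} r≉s fs≈0 with ≈0-* (s - r) (eval q s) (begin
        (s - r) * eval q s     ≡⟨ factor-theorem f s r ⟨
        eval f s - eval f r    ≈⟨ -‿cong fs≈0 fr≈0 ⟩
        0ℤ                     ∎)
      ... | inj₁ s-r≈0  = contradiction (≈-sym (-≈0⇒≈ s-r≈0)) r≉s
      ... | inj₂ qs≈0   = qs≈0

      q≈0 : ∀ x → eval q x ≈ 0ℤ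
      q≈0 = distinct-roots⇒≈0 q rs rs-distinct
              (All.map (λ (r≉s , fs≈0) → root-of-q r≉s fs≈0) (All.zip (r≉rs , frs≈0)))

    square≈1⇒≈±1 : ∀ {x} → x * x ≈ 1ℤ → x ≈ 1ℤ ⊎ x ≈ -1ℤ
    square≈1⇒≈±1 {x} x²≈1 = Sum.map -≈0⇒≈ x+1≈0⇒x≈-1 (≈0-* (x - 1ℤ) (x + 1ℤ) (begin
      (x - 1ℤ) * (x + 1ℤ)   ≡⟨ difference-of-squares x ⟩
      x * x - 1ℤ            ≈⟨ ≈⇒-≈0 x²≈1 ⟩
      0ℤ                    ∎))
      where
      difference-of-squares : ∀ x → (x - 1ℤ) * (x + 1ℤ) ≡ x * x - 1ℤ
      difference-of-squares = solve-∀
      shift : ∀ x → x ≡ (x + 1ℤ) - 1ℤ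
      shift = solve-∀
      x+1≈0⇒x≈-1 : x + 1ℤ ≈ 0ℤ → x ≈ -1ℤ
      x+1≈0⇒x≈-1 x+1≈0 = ≈-trans (≈-reflexive (shift x)) (-‿cong x+1≈0 (≈-refl {1ℤ}))

module Chebyshev (z : ℤ) where
  open import Data.Integer using (_+_; _*_; _-_)
  open ≡.≡-Reasoning

  u : ℕ → ℤ
  u zero          = 0ℤ
  u (suc zero)    = 1ℤ
  u (suc (suc n)) = z * u (suc n) - u n

  u-+ : ∀ m n → u (suc (m ℕ.+ n)) ≡ u (suc m) * u (suc n) - u m * u n
  u-+ zero    n = base (u (suc n)) (u n)
    where
    base : ∀ a b → a ≡ 1ℤ * a - 0ℤ * b
    base = solve-∀
  u-+ (suc m) n = begin
    u (suc (suc m ℕ.+ n))                                   ≡⟨ ≡.cong (u ∘ suc) (ℕₚ.+-suc m n) ⟨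
    u (suc (m ℕ.+ suc n))                                   ≡⟨ u-+ m (suc n) ⟩
    u (suc m) * (z * u (suc n) - u n) - u m * u (suc n)     ≡⟨ step z (u (suc m)) (u m) (u (suc n)) (u n) ⟩
    (z * u (suc m) - u m) * u (suc n) - u (suc m) * u n     ∎
    where
    step : ∀ z a b c d → a * (z * c - d) - b * c ≡ (z * a - b) * c - a * d
    step = solve-∀

module Quadratic (z : ℤ) where
  open import Data.Integer using (_+_; _*_; _-_; -_; _^_)
  open Chebyshev z using (u)

  -- ⟨ a , b ⟩ stands for a + bα, where α² = zα − 1.
  record ℤ[α] : Set where
    constructor ⟨_,_⟩
    field c₀ c₁ : ℤ
  open ℤ[α] public

  open import Algebra.Definitions {A = ℤ[α]} _≡_ using (Associative; LeftIdentity; Commutative; Congruent₂)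
  open import Algebra.Structures {A = ℤ[α]} _≡_ using (IsCommutativeMonoid)
  open import Algebra.Structures.Biased {A = ℤ[α]} _≡_ using (IsCommutativeSemiringˡ; IsCommutativeMonoidˡ)

  infixl 6 _⊕_
  infixl 7 _⊗_

  _⊕_ : ℤ[α] → ℤ[α] → ℤ[α]
  ⟨ a , b ⟩ ⊕ ⟨ c , d ⟩ = ⟨ a + c , b + d ⟩

  _⊗_ : ℤ[α] → ℤ[α] → ℤ[α]
  ⟨ a , b ⟩ ⊗ ⟨ c , d ⟩ = ⟨ a * c - b * d , a * d + b * c + z * (b * d) ⟩

  ι : ℤ → ℤ[α]
  ι a = ⟨ a , 0ℤ ⟩

  α ᾱ : ℤ[α]
  α = ⟨ 0ℤ , 1ℤ ⟩
  ᾱ = ⟨ z , -1ℤ ⟩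

  ⊕-assoc : ∀ x y w → (x ⊕ y) ⊕ w ≡ x ⊕ (y ⊕ w)
  ⊕-assoc ⟨ a , b ⟩ ⟨ c , d ⟩ ⟨ e , f ⟩ = ≡.cong₂ ⟨_,_⟩ (ℤₚ.+-assoc a c e) (ℤₚ.+-assoc b d f)

  ⊕-comm : ∀ x y → x ⊕ y ≡ y ⊕ x
  ⊕-comm ⟨ a , b ⟩ ⟨ c , d ⟩ = ≡.cong₂ ⟨_,_⟩ (ℤₚ.+-comm a c) (ℤₚ.+-comm b d)

  ⊕-identityˡ : ∀ x → ι 0ℤ ⊕ x ≡ x
  ⊕-identityˡ ⟨ a , b ⟩ = ≡.cong₂ ⟨_,_⟩ (ℤₚ.+-identityˡ a) (ℤₚ.+-identityˡ b)

  ⊗-assoc : ∀ x y w → (x ⊗ y) ⊗ w ≡ x ⊗ (y ⊗ w)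
  ⊗-assoc ⟨ a , b ⟩ ⟨ c , d ⟩ ⟨ e , f ⟩ = ≡.cong₂ ⟨_,_⟩ (assoc₀ z a b c d e f) (assoc₁ z a b c d e f)
    where
    assoc₀ : ∀ z a b c d e f →
      let A = a * c - b * d; B = a * d + b * c + z * (b * d)
          C = c * e - d * f; D = c * f + d * e + z * (d * f)
      in A * e - B * f ≡ a * C - b * D
    assoc₀ = solve-∀
    assoc₁ : ∀ z a b c d e f →
      let A = a * c - b * d; B = a * d + b * c + z * (b * d)
          C = c * e - d * f; D = c * f + d * e + z * (d * f)
      in A * f + B * e + z * (B * f) ≡ a * D + b * C + z * (b * D)
    assoc₁ = solve-∀

  ⊗-comm : ∀ x y → x ⊗ y ≡ y ⊗ x
  ⊗-comm ⟨ a , b ⟩ ⟨ c , d ⟩ = ≡.cong₂ ⟨_,_⟩ (comm₀ a b c d) (comm₁ z a b c d)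
    where
    comm₀ : ∀ a b c d → a * c - b * d ≡ c * a - d * b
    comm₀ = solve-∀
    comm₁ : ∀ z a b c d → a * d + b * c + z * (b * d) ≡ c * b + d * a + z * (d * b)
    comm₁ = solve-∀

  ⊗-identityˡ : ∀ x → ι 1ℤ ⊗ x ≡ x
  ⊗-identityˡ ⟨ a , b ⟩ = ≡.cong₂ ⟨_,_⟩ (identity₀ a b) (identity₁ z a b)
    where
    identity₀ : ∀ a b → 1ℤ * a - 0ℤ * b ≡ a
    identity₀ = solve-∀
    identity₁ : ∀ z a b → 1ℤ * b + 0ℤ * a + z * (0ℤ * b) ≡ b
    identity₁ = solve-∀

  ⊗-distribʳ : ∀ x y w → (y ⊕ w) ⊗ x ≡ y ⊗ x ⊕ w ⊗ x
  ⊗-distribʳ ⟨ a , b ⟩ ⟨ c , d ⟩ ⟨ e , f ⟩ = ≡.cong₂ ⟨_,_⟩ (distrib₀ a b c d e f) (distrib₁ z a b c d e f)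
    where
    distrib₀ : ∀ a b c d e f → (c + e) * a - (d + f) * b ≡ (c * a - d * b) + (e * a - f * b)
    distrib₀ = solve-∀
    distrib₁ : ∀ z a b c d e f →
      (c + e) * b + (d + f) * a + z * ((d + f) * b) ≡ (c * b + d * a + z * (d * b)) + (e * b + f * a + z * (f * b))
    distrib₁ = solve-∀

  ⊗-zeroˡ : ∀ x → ι 0ℤ ⊗ x ≡ ι 0ℤ
  ⊗-zeroˡ ⟨ a , b ⟩ = ≡.cong (⟨ 0ℤ ,_⟩) (zero₁ z a b)
    where
    zero₁ : ∀ z a b → 0ℤ * b + 0ℤ * a + z * (0ℤ * b) ≡ 0ℤ
    zero₁ = solve-∀

  commutativeSemiring : CommutativeSemiring 0ℓ 0ℓ
  commutativeSemiring = record
    { Carrier = ℤ[α] ; _≈_ = _≡_ ; _+_ = _⊕_ ; _*_ = _⊗_ ; 0# = ι 0ℤ ; 1# = ι 1ℤ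
    ; isCommutativeSemiring = IsCommutativeSemiringˡ.isCommutativeSemiring (record
      { +-isCommutativeMonoid = commutativeMonoid ⊕-assoc ⊕-identityˡ ⊕-comm (≡.cong₂ _⊕_)
      ; *-isCommutativeMonoid = commutativeMonoid ⊗-assoc ⊗-identityˡ ⊗-comm (≡.cong₂ _⊗_)
      ; distribʳ = ⊗-distribʳ
      ; zeroˡ = ⊗-zeroˡ
      })
    }
    where
    commutativeMonoid : ∀ {_∙_ ε} → Associative _∙_ → LeftIdentity ε _∙_ → Commutative _∙_ → Congruent₂ _∙_ →
                        IsCommutativeMonoid _∙_ ε
    commutativeMonoid assoc identityˡ comm ∙-cong = IsCommutativeMonoidˡ.isCommutativeMonoid (record
      { isSemigroup = record { isMagma = record { isEquivalence = ≡.isEquivalence ; ∙-cong = ∙-cong } ; assoc = assoc }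
      ; identityˡ = identityˡ
      ; comm = comm
      })

  open import Algebra.Properties.CommutativeSemiring.Exp commutativeSemiring public
    using () renaming (_^_ to _^ᵅ_)
  open import Algebra.Properties.Semiring.Mult (CommutativeSemiring.semiring commutativeSemiring) public
    using () renaming (_×_ to _×ᵅ_)

  ×-components : ∀ n a b → n ×ᵅ ⟨ a , b ⟩ ≡ ⟨ + n * a , + n * b ⟩
  ×-components zero    a b = ≡.refl
  ×-components (suc n) a b = ≡.trans (≡.cong (⟨ a , b ⟩ ⊕_) (×-components n a b))
                                     (≡.sym (≡.cong₂ ⟨_,_⟩ (ℤₚ.suc-* (+ n) a) (ℤₚ.suc-* (+ n) b)))

  ι-⊗ : ∀ a b → ι a ⊗ ι b ≡ ι (a * b)
  ι-⊗ a b = ≡.cong₂ ⟨_,_⟩ (product₀ a b) (product₁ z a b)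
    where
    product₀ : ∀ a b → a * b - 0ℤ * 0ℤ ≡ a * b
    product₀ = solve-∀
    product₁ : ∀ z a b → a * 0ℤ + 0ℤ * b + z * (0ℤ * 0ℤ) ≡ 0ℤ
    product₁ = solve-∀

  ι-^ : ∀ a n → ι a ^ᵅ n ≡ ι (a ^ n)
  ι-^ a zero    = ≡.refl
  ι-^ a (suc n) = ≡.trans (≡.cong (ι a ⊗_) (ι-^ a n)) (ι-⊗ a (a ^ n))

  α^[1+n] : ∀ n → α ^ᵅ suc n ≡ ⟨ - u n , u (suc n) ⟩
  α^[1+n] zero    = CommutativeSemiring.*-identityʳ commutativeSemiring α
  α^[1+n] (suc n) = ≡.trans (≡.cong (α ⊗_) (α^[1+n] n))
                            (≡.cong₂ ⟨_,_⟩ (step₀ (u n) (u (suc n))) (step₁ z (u n) (u (suc n))))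
    where
    step₀ : ∀ a b → 0ℤ * - a - 1ℤ * b ≡ - b
    step₀ = solve-∀
    step₁ : ∀ z a b → 0ℤ * b + 1ℤ * - a + z * (1ℤ * b) ≡ z * b - a
    step₁ = solve-∀

  ᾱ^n : ∀ n → ᾱ ^ᵅ n ≡ ⟨ u (suc n) , - u n ⟩
  ᾱ^n zero    = ≡.refl
  ᾱ^n (suc n) = ≡.trans (≡.cong (ᾱ ⊗_) (ᾱ^n n))
                        (≡.cong₂ ⟨_,_⟩ (step₀ z (u (suc n)) (u n)) (step₁ z (u (suc n)) (u n)))
    where
    step₀ : ∀ z a b → z * a - -1ℤ * - b ≡ z * a - b
    step₀ = solve-∀
    step₁ : ∀ z a b → z * - b + -1ℤ * a + z * (-1ℤ * - b) ≡ - a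
    step₁ = solve-∀

  ᾱ⊗α≡1 : ᾱ ⊗ α ≡ ι 1ℤ
  ᾱ⊗α≡1 = ≡.cong₂ ⟨_,_⟩ (product₀ z) (product₁ z)
    where
    product₀ : ∀ z → z * 0ℤ - -1ℤ * 1ℤ ≡ 1ℤ
    product₀ = solve-∀
    product₁ : ∀ z → z * 1ℤ + -1ℤ * 0ℤ + z * (-1ℤ * 1ℤ) ≡ 0ℤ
    product₁ = solve-∀

  α⊕ᾱ≡ι[z] : α ⊕ ᾱ ≡ ι z
  α⊕ᾱ≡ι[z] = ≡.cong (⟨_, 0ℤ ⟩) (ℤₚ.+-identityˡ z)

  α⊕ι[c]≡⟨c,1⟩ : ∀ c → α ⊕ ι c ≡ ⟨ c , 1ℤ ⟩
  α⊕ι[c]≡⟨c,1⟩ c = ≡.cong (⟨_, 1ℤ ⟩) (ℤₚ.+-identityˡ c)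

  ⟨c,1⟩²≡ι[z+2c]⊗α : ∀ c → c * c ≡ 1ℤ → ⟨ c , 1ℤ ⟩ ⊗ ⟨ c , 1ℤ ⟩ ≡ ι (z + + 2 * c) ⊗ α
  ⟨c,1⟩²≡ι[z+2c]⊗α c c²≡1 = ≡.cong₂ ⟨_,_⟩ (≡.trans (≡.cong (_- 1ℤ * 1ℤ) c²≡1) (square₀ z c)) (square₁ z c)
    where
    square₀ : ∀ z c → 1ℤ - 1ℤ * 1ℤ ≡ (z + + 2 * c) * 0ℤ - 0ℤ * 1ℤ
    square₀ = solve-∀
    square₁ : ∀ z c → c * 1ℤ + 1ℤ * c + z * (1ℤ * 1ℤ) ≡ (z + + 2 * c) * 1ℤ + 0ℤ * 0ℤ + z * (0ℤ * 1ℤ)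
    square₁ = solve-∀

module Reduction (p : ℕ) (p-prime : Prime p) where
  open import Data.Integer using (_+_; _*_; _-_; -_)
  open Modulo p
  open Field p-prime
  open import Relation.Binary.Reasoning.Setoid ≈-setoid

  infix 4 _↦_
  record _↦_ (x : ℚ) (e : ℤ) : Set where
    constructor mk↦
    field
      p∤↧x : p ∤ ↧ₙ x
      ↥x≈e*↧x : ↥ x ≈ e * ↧ x

  private
    p∤product : ∀ {m n} → p ∤ m → p ∤ n → p ∤ m ℕ.* n
    p∤product {m} {n} p∤m p∤n p∣mn = [ p∤m , p∤n ]′ (euclidsLemma m n p-prime p∣mn)

  ↦-via-≃ : ∀ {x s e} → toℚᵘ x ℚᵘ.≃ s → p ∤ ℚᵘ.↧ₙ s → ℚᵘ.↥ s ≈ e * ℚᵘ.↧ s → x ↦ e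
  ↦-via-≃ {mkℚ n d-1 coprime} {s} {e} (*≡* n*↧s≡↥s*d) p∤↧s ↥s≈e*↧s = mk↦ p∤d n≈e*d
    where
    d : ℤ
    d = + suc d-1
    n*↧s≈e*d*↧s : n * ℚᵘ.↧ s ≈ e * d * ℚᵘ.↧ s
    n*↧s≈e*d*↧s = begin
      n * ℚᵘ.↧ s        ≡⟨ n*↧s≡↥s*d ⟩
      ℚᵘ.↥ s * d        ≈⟨ *-cong ↥s≈e*↧s (≈-refl {d}) ⟩
      e * ℚᵘ.↧ s * d    ≡⟨ swap e (ℚᵘ.↧ s) d ⟩
      e * d * ℚᵘ.↧ s    ∎
      where
      swap : ∀ a b c → a * b * c ≡ a * c * b
      swap = solve-∀
    n≈e*d : n ≈ e * d
    n≈e*d = *-cancelʳ-≈ (∤⇒≉0 p∤↧s) n*↧s≈e*d*↧s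
    p∤d : p ∤ suc d-1
    p∤d p∣d = prime⇒≢1 p-prime (recompute coprime (≈0⇒∣ n≈0 , p∣d))
      where
      n≈0 : n ≈ 0ℤ
      n≈0 = ≈-trans n≈e*d (≈-trans (*-cong (≈-refl {e}) (∣⇒≈0 p∣d)) (≈-reflexive (ℤₚ.*-zeroʳ e)))

  ↦-+ : ∀ {x y a b} → x ↦ a → y ↦ b → x ℚ.+ y ↦ a + b
  ↦-+ {x@(mkℚ _ _ _)} {y@(mkℚ _ _ _)} {a} {b} (mk↦ p∤↧x ↥x≈a↧x) (mk↦ p∤↧y ↥y≈b↧y) =
    ↦-via-≃ (toℚᵘ-homo-+ x y) (p∤product p∤↧x p∤↧y) (begin
      ↥ x * ↧ y + ↥ y * ↧ x              ≈⟨ +-cong (*-cong ↥x≈a↧x (≈-refl {↧ y})) (*-cong ↥y≈b↧y (≈-refl {↧ x})) ⟩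
      a * ↧ x * ↧ y + b * ↧ y * ↧ x      ≡⟨ collect a b (↧ x) (↧ y) ⟩
      (a + b) * (↧ x * ↧ y)              ∎)
    where
    collect : ∀ a b m n → a * m * n + b * n * m ≡ (a + b) * (m * n)
    collect = solve-∀

  ↦-* : ∀ {x y a b} → x ↦ a → y ↦ b → x ℚ.* y ↦ a * b
  ↦-* {x@(mkℚ _ _ _)} {y@(mkℚ _ _ _)} {a} {b} (mk↦ p∤↧x ↥x≈a↧x) (mk↦ p∤↧y ↥y≈b↧y) =
    ↦-via-≃ (toℚᵘ-homo-* x y) (p∤product p∤↧x p∤↧y) (begin
      ↥ x * ↥ y                    ≈⟨ *-cong ↥x≈a↧x ↥y≈b↧y ⟩
      a * ↧ x * (b * ↧ y)          ≡⟨ interchange a b (↧ x) (↧ y) ⟩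
      a * b * (↧ x * ↧ y)          ∎)
    where
    interchange : ∀ a b m n → a * m * (b * n) ≡ a * b * (m * n)
    interchange = solve-∀

  ↦-neg : ∀ {x a} → x ↦ a → ℚ.- x ↦ - a
  ↦-neg {x} {a} (mk↦ p∤↧x ↥x≈a↧x) = mk↦ (≡.subst (p ∤_) (≡.sym (≡.cong ∣_∣ (↧-neg x))) p∤↧x) (begin
    ↥ (ℚ.- x)     ≡⟨ ↥-neg x ⟩
    - ↥ x         ≈⟨ neg-cong ↥x≈a↧x ⟩
    - (a * ↧ x)   ≡⟨ ℤₚ.neg-distribˡ-* a (↧ x) ⟩
    - a * ↧ x     ≡⟨ ≡.cong (- a *_) (↧-neg x) ⟨
    - a * ↧ (ℚ.- x) ∎)

  ↦-- : ∀ {x y a b} → x ↦ a → y ↦ b → x ℚ.- y ↦ a - b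
  ↦-- x↦a y↦b = ↦-+ x↦a (↦-neg y↦b)

  ↦-/1 : ∀ i → i ℚ./ 1 ↦ i
  ↦-/1 i = ↦-via-≃ (toℚᵘ-fromℚᵘ (mkℚᵘ i 0)) (λ p∣1 → prime⇒≢1 p-prime (∣1⇒≡1 p∣1))
                   (≈-reflexive (≡.sym (ℤₚ.*-identityʳ i)))

  ↦-≈⇒≡[mod] : ∀ {x y a b} → x ↦ a → y ↦ b → a ≈ b → x ≡ y [mod p ]
  ↦-≈⇒≡[mod] {x} {y} {a} {b} x↦a y↦b a≈b = ≈0⇒∣ (begin
    ↥ (x ℚ.- y)               ≈⟨ _↦_.↥x≈e*↧x (↦-- x↦a y↦b) ⟩
    (a - b) * ↧ (x ℚ.- y)     ≈⟨ *-cong (≈⇒-≈0 a≈b) (≈-refl {↧ (x ℚ.- y)}) ⟩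
    0ℤ * ↧ (x ℚ.- y)          ≡⟨⟩
    0ℤ                        ∎)

open import Data.Product using (_×_)

-- For k = p / 2 this is the conclusion of proposition7, with V p q and W p q unfolded.
ChebyshevCongruences : ℚ → ℕ → ℕ → Set
ChebyshevCongruences q k p =
    (C p q ≡ q [mod p ])
  × ((U (suc k) q ℚ.- U k q) ≡ legendreℚ (q ℚ.+ (+ 2) ℚ./ 1) p [mod p ])
  × ((U (suc k) q ℚ.+ U k q) ≡ legendreℚ (q ℚ.- (+ 2) ℚ./ 1) p [mod p ])
  × (U p q ≡ legendreℚ (q ℚ.* q ℚ.- (+ 4) ℚ./ 1) p [mod p ])

module OddPrime (k : ℕ) (p-prime : Prime (suc (k ℕ.+ k))) where
  open import Data.Integer using (_+_; _*_; _-_; -_; _^_)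
  open Polynomial

  p : ℕ
  p = suc (k ℕ.+ k)

  open Modulo p
  open Field p-prime
  open Reduction p p-prime
  open import Relation.Binary.Reasoning.Setoid ≈-setoid

  k≢0 : k ≢ 0
  k≢0 k≡0 = prime⇒≢1 p-prime (≡.cong (λ m → suc (m ℕ.+ m)) k≡0)

  fermat-unit : ∀ {a} → a ≉ 0ℤ → a ^ (k ℕ.+ k) ≈ 1ℤ
  fermat-unit {a} a≉0 = *-cancelʳ-≈ a≉0 (begin
    a ^ (k ℕ.+ k) * a   ≡⟨ ℤₚ.*-comm (a ^ (k ℕ.+ k)) a ⟩
    a ^ p               ≈⟨ fermat a ⟩
    a                   ≡⟨ ℤₚ.*-identityˡ a ⟨
    1ℤ * a              ∎)

  square^k : ∀ t → (t * t) ^ k ≡ t ^ (k ℕ.+ k)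
  square^k t = ≡.trans (^-distribʳ-* t t k) (≡.sym (ℤₚ.^-distribˡ-+-* t k k))

  euler-residue : ∀ {c t} → c ≉ 0ℤ → t * t ≈ c → c ^ k ≈ 1ℤ
  euler-residue {c} {t} c≉0 t²≈c = begin
    c ^ k             ≈⟨ ^-cong k t²≈c ⟨
    (t * t) ^ k       ≡⟨ square^k t ⟩
    t ^ (k ℕ.+ k)     ≈⟨ fermat-unit t≉0 ⟩
    1ℤ                ∎
    where
    t≉0 : t ≉ 0ℤ
    t≉0 t≈0 = c≉0 (≈-trans (≈-sym t²≈c) (*-cong t≈0 t≈0))

  small≉0 : ∀ {m} → 0 < m → m ≤ k ℕ.+ k → + m ≉ 0ℤ
  small≉0 0<m m≤2k = +≉0 0<m (s≤s m≤2k)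

  0^k≡0 : 0ℤ ^ k ≡ 0ℤ
  0^k≡0 = ≡.subst (λ n → 0ℤ ^ n ≡ 0ℤ) (ℕₚ.suc-pred k {{ℕ.≢-nonZero k≢0}}) ≡.refl

  squares : ∀ m → Vec ℤ m
  squares zero    = []
  squares (suc m) = + suc m * + suc m ∷ squares m

  square-≉ : ∀ {a s} → 0 < a → a < s → s ≤ k → + s * + s ≉ + a * + a
  square-≉ {a} {s} 0<a a<s s≤k s²≈a² = *-≉0 (small≉0 0<d d≤2k) (small≉0 0<a+s a+s≤2k) (begin
    + d * + (a ℕ.+ s)        ≡⟨ factor ⟩
    + s * + s - + a * + a    ≈⟨ ≈⇒-≈0 s²≈a² ⟩
    0ℤ                       ∎)
    where
    d : ℕ
    d = s ℕ.∸ a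
    s≡a+d : + s ≡ + a + + d
    s≡a+d = ≡.cong +_ (≡.sym (ℕₚ.m+[n∸m]≡n (ℕₚ.<⇒≤ a<s)))
    0<d : 0 < d
    0<d = ℕₚ.m<n⇒0<n∸m a<s
    d≤2k : d ≤ k ℕ.+ k
    d≤2k = ℕₚ.≤-trans (ℕₚ.m∸n≤m s a) (ℕₚ.≤-trans s≤k (ℕₚ.m≤m+n k k))
    0<a+s : 0 < a ℕ.+ s
    0<a+s = ℕₚ.<-≤-trans 0<a (ℕₚ.m≤m+n a s)
    a+s≤2k : a ℕ.+ s ≤ k ℕ.+ k
    a+s≤2k = ℕₚ.+-mono-≤ (ℕₚ.≤-trans (ℕₚ.<⇒≤ a<s) s≤k) s≤k
    difference-of-squares : ∀ a d → d * (a + (a + d)) ≡ (a + d) * (a + d) - a * a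
    difference-of-squares = solve-∀
    factor : + d * + (a ℕ.+ s) ≡ + s * + s - + a * + a
    factor = ≡.trans (≡.cong (λ t → + d * (+ a + t)) s≡a+d)
               (≡.trans (difference-of-squares (+ a) (+ d)) (≡.cong (λ t → t * t - + a * + a) (≡.sym s≡a+d)))

  squares-distinct : ∀ m → m ≤ k → AllPairs _≉_ (squares m)
  squares-distinct zero    _     = []
  squares-distinct (suc m) 1+m≤k = head m (ℕₚ.n<1+n m) ∷ squares-distinct m (ℕₚ.<⇒≤ 1+m≤k)
    where
    head : ∀ n → n < suc m → All (+ suc m * + suc m ≉_) (squares n)
    head zero    _     = []
    head (suc n) n<1+m = square-≉ (s≤s z≤n) n<1+m 1+m≤k ∷ head n (ℕₚ.<-trans (ℕₚ.n<1+n n) n<1+m)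

  squares-roots : ∀ m → m ≤ k → All (λ r → eval (xᵏ-1 k) r ≈ 0ℤ) (squares m)
  squares-roots zero    _     = []
  squares-roots (suc m) 1+m≤k = root ∷ squares-roots m (ℕₚ.<⇒≤ 1+m≤k)
    where
    s : ℤ
    s = + suc m
    s≉0 : s ≉ 0ℤ
    s≉0 = small≉0 (s≤s z≤n) (ℕₚ.≤-trans 1+m≤k (ℕₚ.m≤m+n k k))
    root : eval (xᵏ-1 k) (s * s) ≈ 0ℤ
    root = begin
      eval (xᵏ-1 k) (s * s)  ≡⟨ eval-xᵏ-1 k (s * s) ⟩
      (s * s) ^ k - 1ℤ       ≡⟨ ≡.cong (_- 1ℤ) (square^k s) ⟩
      s ^ (k ℕ.+ k) - 1ℤ     ≈⟨ -‿cong (fermat-unit s≉0) (≈-refl {1ℤ}) ⟩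
      1ℤ - 1ℤ                ≡⟨⟩
      0ℤ                     ∎

  -- Otherwise xᵏ − 1 would have the k + 1 distinct roots c, 1², …, k² in 𝔽_p.
  nonresidue^k≉1 : ∀ {c} → (∀ t → t * t ≉ c) → c ^ k ≉ 1ℤ
  nonresidue^k≉1 {c} nonresidue c^k≈1 = 1≉0 (begin
    1ℤ                         ≡⟨ ≡.cong -_ (≡.trans (eval-xᵏ-1 k 0ℤ) (≡.cong (_- 1ℤ) 0^k≡0)) ⟨
    - eval (xᵏ-1 k) 0ℤ         ≈⟨ neg-cong (distinct-roots⇒≈0 (xᵏ-1 k) (c ∷ squares k) distinct roots 0ℤ) ⟩
    0ℤ                         ∎)
    where
    c≉squares : ∀ m → All (c ≉_) (squares m)
    c≉squares zero    = []
    c≉squares (suc m) = (λ c≈s² → nonresidue (+ suc m) (≈-sym c≈s²)) ∷ c≉squares m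
    distinct : AllPairs _≉_ (c ∷ squares k)
    distinct = c≉squares k ∷ squares-distinct k ℕₚ.≤-refl
    roots : All (λ r → eval (xᵏ-1 k) r ≈ 0ℤ) (c ∷ squares k)
    roots = ≈-trans (≈-reflexive (eval-xᵏ-1 k c)) (≈⇒-≈0 c^k≈1) ∷ squares-roots k ℕₚ.≤-refl

  euler-nonresidue : ∀ {c} → c ≉ 0ℤ → (∀ t → t * t ≉ c) → c ^ k ≈ -1ℤ
  euler-nonresidue {c} c≉0 nonresidue =
    [ (λ c^k≈1 → contradiction c^k≈1 (nonresidue^k≉1 nonresidue)) , id ]′ (square≈1⇒≈±1 (begin
      c ^ k * c ^ k     ≡⟨ ℤₚ.^-distribˡ-+-* c k k ⟨
      c ^ (k ℕ.+ k)     ≈⟨ fermat-unit c≉0 ⟩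
      1ℤ                ∎))

  module _ (z : ℤ) where
    open Chebyshev z
    open Quadratic z
    open CommutativeSemiring commutativeSemiring using (semiring)

    infix 4 _≋_
    record _≋_ (x y : ℤ[α]) : Set where
      constructor _,_
      field
        c₀-≈ : c₀ x ≈ c₀ y
        c₁-≈ : c₁ x ≈ c₁ y
    open _≋_

    ≡⇒≋ : ∀ {x y} → x ≡ y → x ≋ y
    ≡⇒≋ ≡.refl = ≈-refl , ≈-refl

    ≋-trans : ∀ {x y w} → x ≋ y → y ≋ w → x ≋ w
    ≋-trans (x₀≈y₀ , x₁≈y₁) (y₀≈w₀ , y₁≈w₁) = ≈-trans x₀≈y₀ y₀≈w₀ , ≈-trans x₁≈y₁ y₁≈w₁

    ⊗-congˡ-≋ : ∀ w {x y} → x ≋ y → w ⊗ x ≋ w ⊗ y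
    ⊗-congˡ-≋ ⟨ a , b ⟩ (x₀≈y₀ , x₁≈y₁) =
      -‿cong (*-cong (≈-refl {a}) x₀≈y₀) (*-cong (≈-refl {b}) x₁≈y₁) ,
      +-cong (+-cong (*-cong (≈-refl {a}) x₁≈y₁) (*-cong (≈-refl {b}) x₀≈y₀))
             (*-cong (≈-refl {z}) (*-cong (≈-refl {b}) x₁≈y₁))

    ⊕-congˡ-≋ : ∀ w {x y} → x ≋ y → w ⊕ x ≋ w ⊕ y
    ⊕-congˡ-≋ w (x₀≈y₀ , x₁≈y₁) = +-cong (≈-refl {c₀ w}) x₀≈y₀ , +-cong (≈-refl {c₁ w}) x₁≈y₁

    frobenius-≋ : ∀ x y → (x ⊕ y) ^ᵅ p ≋ x ^ᵅ p ⊕ y ^ᵅ p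
    frobenius-≋ x y = ≋-trans (≡⇒≋ expansion′) (drop (c₀ w) , drop (c₁ w))
      where
      X : ℤ[α]
      X = x ^ᵅ p ⊕ y ^ᵅ p
      expansion : ∃[ w ] (x ⊕ y) ^ᵅ p ≡ X ⊕ p ×ᵅ w
      expansion = frobenius semiring p-prime x y (⊗-comm x y)
      w : ℤ[α]
      w = proj₁ expansion
      expansion′ : (x ⊕ y) ^ᵅ p ≡ X ⊕ ⟨ + p * c₀ w , + p * c₁ w ⟩
      expansion′ = ≡.trans (proj₂ expansion) (≡.cong (X ⊕_) (×-components p (c₀ w) (c₁ w)))
      drop : ∀ {a} c → a + + p * c ≈ a
      drop {a} c = ≈-trans (+-cong (≈-refl {a}) (multiple≈0 c)) (≈-reflexive (ℤₚ.+-identityʳ a))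

    u[1+p]-u[p-1]≈z : u (suc p) - u (k ℕ.+ k) ≈ z
    u[1+p]-u[p-1]≈z = ≈-sym (begin
      z                              ≈⟨ fermat z ⟨
      z ^ p                          ≡⟨ ≡.cong c₀ (ι-^ z p) ⟨
      c₀ (ι z ^ᵅ p)                  ≡⟨ ≡.cong (λ t → c₀ (t ^ᵅ p)) α⊕ᾱ≡ι[z] ⟨
      c₀ ((α ⊕ ᾱ) ^ᵅ p)              ≈⟨ c₀-≈ (frobenius-≋ α ᾱ) ⟩
      c₀ (α ^ᵅ p ⊕ ᾱ ^ᵅ p)           ≡⟨ ≡.cong₂ (λ x y → c₀ (x ⊕ y)) (α^[1+n] (k ℕ.+ k)) (ᾱ^n p) ⟩
      - u (k ℕ.+ k) + u (suc p)      ≡⟨ ℤₚ.+-comm (- u (k ℕ.+ k)) (u (suc p)) ⟩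
      u (suc p) - u (k ℕ.+ k)        ∎)

    u[1+k]-c*u[k]≈[z+2c]^k : ∀ c → c * c ≡ 1ℤ → u (suc k) - c * u k ≈ (z + + 2 * c) ^ k
    u[1+k]-c*u[k]≈[z+2c]^k c c²≡1 = ≈-sym (begin
      e ^ k                                                      ≡⟨ c₁[⟨c,1⟩⊗ι[e]] z c (e ^ k) ⟨
      c₁ (β ⊗ ι (e ^ k))                                         ≡⟨ ≡.cong (λ t → c₁ (β ⊗ t)) (ι-^ e k) ⟨
      c₁ (β ⊗ ι e ^ᵅ k)                                          ≡⟨ ≡.cong c₁ ᾱᵏβᵖ≡βeᵏ ⟨
      c₁ (ᾱ ^ᵅ k ⊗ β ^ᵅ p)                                       ≈⟨ c₁-≈ (⊗-congˡ-≋ (ᾱ ^ᵅ k) β^p≋α^p⊕ι[c]) ⟩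
      c₁ (ᾱ ^ᵅ k ⊗ (α ^ᵅ p ⊕ ι c))                               ≡⟨ ≡.cong c₁ ᾱᵏ[αᵖ+c]≡αᵏ⁺¹+cᾱᵏ ⟩
      c₁ (α ^ᵅ suc k ⊕ ι c ⊗ ᾱ ^ᵅ k)
        ≡⟨ ≡.cong₂ (λ x y → c₁ (x ⊕ ι c ⊗ y)) (α^[1+n] k) (ᾱ^n k) ⟩
      c₁ (⟨ - u k , u (suc k) ⟩ ⊕ ι c ⊗ ⟨ u (suc k) , - u k ⟩)  ≡⟨ closed-form z c (u (suc k)) (u k) ⟩
      u (suc k) - c * u k                                        ∎)
      where
      e : ℤ
      e = z + + 2 * c
      β : ℤ[α]
      β = ⟨ c , 1ℤ ⟩
      ᾱᵏβᵖ≡βeᵏ : ᾱ ^ᵅ k ⊗ β ^ᵅ p ≡ β ⊗ ι e ^ᵅ k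
      ᾱᵏβᵖ≡βeᵏ = v^n*x^[1+n+n]≈x*y^n commutativeSemiring {ᾱ} {α} {β} {ι e} k ᾱ⊗α≡1
                   (⟨c,1⟩²≡ι[z+2c]⊗α c c²≡1)
      ᾱᵏ[αᵖ+c]≡αᵏ⁺¹+cᾱᵏ : ᾱ ^ᵅ k ⊗ (α ^ᵅ p ⊕ ι c) ≡ α ^ᵅ suc k ⊕ ι c ⊗ ᾱ ^ᵅ k
      ᾱᵏ[αᵖ+c]≡αᵏ⁺¹+cᾱᵏ = v^n*[w^[1+n+n]+c]≈w^[1+n]+c*v^n commutativeSemiring {ᾱ} {α} k (ι c) ᾱ⊗α≡1
      β^p≋α^p⊕ι[c] : β ^ᵅ p ≋ α ^ᵅ p ⊕ ι c
      β^p≋α^p⊕ι[c] = ≋-trans (≡⇒≋ (≡.cong (_^ᵅ p) (≡.sym (α⊕ι[c]≡⟨c,1⟩ c))))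
                       (≋-trans (frobenius-≋ α (ι c))
                                (⊕-congˡ-≋ (α ^ᵅ p) (≋-trans (≡⇒≋ (ι-^ c p)) (fermat c , ≈-refl))))
      c₁[⟨c,1⟩⊗ι[e]] : ∀ z c e → c * 0ℤ + 1ℤ * e + z * (1ℤ * 0ℤ) ≡ e
      c₁[⟨c,1⟩⊗ι[e]] = solve-∀
      closed-form : ∀ z c a b → a + (c * - b + 0ℤ * a + z * (0ℤ * - b)) ≡ a - c * b
      closed-form = solve-∀

    u[1+k]-u[k]≈[z+2]^k : u (suc k) - u k ≈ (z + + 2) ^ k
    u[1+k]-u[k]≈[z+2]^k = ≈-trans (≈-reflexive (≡.cong (λ t → u (suc k) - t) (≡.sym (ℤₚ.*-identityˡ (u k)))))
                                  (u[1+k]-c*u[k]≈[z+2c]^k 1ℤ ≡.refl)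

    u[1+k]+u[k]≈[z-2]^k : u (suc k) + u k ≈ (z - + 2) ^ k
    u[1+k]+u[k]≈[z-2]^k = ≈-trans (≈-reflexive (sign-flip (u (suc k)) (u k)))
                                  (u[1+k]-c*u[k]≈[z+2c]^k -1ℤ ≡.refl)
      where
      sign-flip : ∀ a b → a + b ≡ a - -1ℤ * b
      sign-flip = solve-∀

    u[p]≈[[z+2][z-2]]^k : u p ≈ ((z + + 2) * (z - + 2)) ^ k
    u[p]≈[[z+2][z-2]]^k = begin
      u p                                        ≡⟨ u-+ k k ⟩
      u (suc k) * u (suc k) - u k * u k          ≡⟨ difference-of-squares (u (suc k)) (u k) ⟩
      (u (suc k) - u k) * (u (suc k) + u k)      ≈⟨ *-cong u[1+k]-u[k]≈[z+2]^k u[1+k]+u[k]≈[z-2]^k ⟩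
      (z + + 2) ^ k * (z - + 2) ^ k              ≡⟨ ^-distribʳ-* (z + + 2) (z - + 2) k ⟨
      ((z + + 2) * (z - + 2)) ^ k                ∎
      where
      difference-of-squares : ∀ a b → a * a - b * b ≡ (a - b) * (a + b)
      difference-of-squares = solve-∀

  -- The witness ↥x · ↧x^(p − 2) is ↥x / ↧x by Fermat.
  reduction-exists : ∀ x → p ∤ ↧ₙ x → ∃[ e ] x ↦ e
  reduction-exists x p∤↧x = ↥ x * ↧ x ^ (ℕ.pred k ℕ.+ k) , mk↦ p∤↧x (≈-sym (begin
    ↥ x * ↧ x ^ (ℕ.pred k ℕ.+ k) * ↧ x      ≡⟨ ℤₚ.*-assoc (↥ x) _ (↧ x) ⟩
    ↥ x * (↧ x ^ (ℕ.pred k ℕ.+ k) * ↧ x)    ≡⟨ ≡.cong (↥ x *_) (ℤₚ.*-comm _ (↧ x)) ⟩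
    ↥ x * ↧ x ^ suc (ℕ.pred k ℕ.+ k)
      ≡⟨ ≡.cong (λ m → ↥ x * ↧ x ^ (m ℕ.+ k)) (ℕₚ.suc-pred k {{ℕ.≢-nonZero k≢0}}) ⟩
    ↥ x * ↧ x ^ (k ℕ.+ k)                   ≈⟨ *-cong (≈-refl {↥ x}) (fermat-unit (∤⇒≉0 p∤↧x)) ⟩
    ↥ x * 1ℤ                                ≡⟨ ℤₚ.*-identityʳ (↥ x) ⟩
    ↥ x                                     ∎))

  reduction-power : ∀ {x e} → x ↦ e → (↥ x * ↧ x) ^ k ≈ e ^ k
  reduction-power {x} {e} (mk↦ p∤↧x ↥x≈e*↧x) = begin
    (↥ x * ↧ x) ^ k                ≈⟨ ^-cong k (*-cong ↥x≈e*↧x (≈-refl {↧ x})) ⟩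
    (e * ↧ x * ↧ x) ^ k            ≡⟨ ≡.cong (_^ k) (ℤₚ.*-assoc e (↧ x) (↧ x)) ⟩
    (e * (↧ x * ↧ x)) ^ k          ≡⟨ ^-distribʳ-* e (↧ x * ↧ x) k ⟩
    e ^ k * (↧ x * ↧ x) ^ k        ≡⟨ ≡.cong (e ^ k *_) (square^k (↧ x)) ⟩
    e ^ k * ↧ x ^ (k ℕ.+ k)        ≈⟨ *-cong (≈-refl {e ^ k}) (fermat-unit (∤⇒≉0 p∤↧x)) ⟩
    e ^ k * 1ℤ                     ≡⟨ ℤₚ.*-identityʳ (e ^ k) ⟩
    e ^ k                          ∎

  ↥*↧≉0 : ∀ {x} → p ∤ ∣ ↥ x ∣ → p ∤ ↧ₙ x → ↥ x * ↧ x ≉ 0ℤ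
  ↥*↧≉0 {x} p∤↥x p∤↧x = *-≉0 {↥ x} {↧ x} (λ ↥x≈0 → p∤↥x (≈0⇒∣ ↥x≈0)) (∤⇒≉0 p∤↧x)

  legendre-≈ : ∀ {x e} → x ↦ e → legendre x p ≈ e ^ k
  legendre-≈ {x} {e} x↦e@(mk↦ p∤↧x ↥x≈e*↧x) with p ∣? ∣ ↥ x ∣
  ... | yes p∣↥x = ≈-sym (begin
    e ^ k      ≈⟨ ^-cong k e≈0 ⟩
    0ℤ ^ k     ≡⟨ 0^k≡0 ⟩
    0ℤ         ∎)
    where
    e≈0 : e ≈ 0ℤ
    e≈0 = [ id , (λ ↧x≈0 → contradiction ↧x≈0 (∤⇒≉0 p∤↧x)) ]′
            (≈0-* e (↧ x) (≈-trans (≈-sym ↥x≈e*↧x) (∣⇒≈0 p∣↥x)))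
  ... | no p∤↥x with any? {n = p} (λ (t : Fin p) → p ∣? ∣ (+ toℕ t) * (+ toℕ t) - (↥ x) * (+ (↧ₙ x)) ∣)
  ...   | yes (t , p∣t²-c) =
    ≈-trans (≈-sym (euler-residue {t = + toℕ t} (↥*↧≉0 {x} p∤↥x p∤↧x) t²≈c)) (reduction-power x↦e)
    where
    t²≈c : + toℕ t * + toℕ t ≈ ↥ x * ↧ x
    t²≈c = -≈0⇒≈ (∣⇒≈0 {+ toℕ t * + toℕ t - ↥ x * ↧ x} p∣t²-c)
  ...   | no ∄t = ≈-trans (≈-sym (euler-nonresidue c≉0 nonresidue)) (reduction-power x↦e)
    where
    c≉0 : ↥ x * ↧ x ≉ 0ℤ
    c≉0 = ↥*↧≉0 {x} p∤↥x p∤↧x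
    nonresidue : ∀ t → t * t ≉ ↥ x * ↧ x
    nonresidue t t²≈c = ∄t (fromℕ< r<p , ≡.subst (λ m → p ∣ ∣ + m * + m - ↥ x * ↧ x ∣) (≡.sym (toℕ-fromℕ< r<p))
                                                   (≈0⇒∣ (≈⇒-≈0 r²≈c)))
      where
      r<p : t %ℕ p < p
      r<p = n%ℕd<d t p
      r²≈c : + (t %ℕ p) * + (t %ℕ p) ≈ ↥ x * ↧ x
      r²≈c = ≈-trans (*-cong (≈-sym (≈-%ℕ t)) (≈-sym (≈-%ℕ t))) t²≈c

  chebyshev-congruences : ∀ q → ¬ (p ∈𝒟 q) → ChebyshevCongruences q k p
  chebyshev-congruences q p∉𝒟q =
      ↦-≈⇒≡[mod] (↦-- (U↦u (suc p)) (U↦u (k ℕ.+ k))) q↦z (u[1+p]-u[p-1]≈z z)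
    , ↦-≈⇒≡[mod] (↦-- (U↦u (suc k)) (U↦u k)) (↦-/1 _)
        (≈-trans (u[1+k]-u[k]≈[z+2]^k z) (≈-sym (legendre-≈ (↦-+ q↦z (↦-/1 (+ 2))))))
    , ↦-≈⇒≡[mod] (↦-+ (U↦u (suc k)) (U↦u k)) (↦-/1 _)
        (≈-trans (u[1+k]+u[k]≈[z-2]^k z) (≈-sym (legendre-≈ (↦-- q↦z (↦-/1 (+ 2))))))
    , ↦-≈⇒≡[mod] (U↦u p) (↦-/1 _)
        (≈-trans (u[p]≈[[z+2][z-2]]^k z) (≈-trans (≈-reflexive (≡.cong (_^ k) (difference-of-squares z)))
                                               (≈-sym (legendre-≈ (↦-- (↦-* q↦z q↦z) (↦-/1 (+ 4)))))))
    where
    z : ℤ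
    z = proj₁ (reduction-exists q p∉𝒟q)
    q↦z : q ↦ z
    q↦z = proj₂ (reduction-exists q p∉𝒟q)
    open Chebyshev z using (u)
    U↦u : ∀ n → U n q ↦ u n
    U↦u zero          = ↦-/1 0ℤ
    U↦u (suc zero)    = ↦-/1 1ℤ
    U↦u (suc (suc n)) = ↦-- (↦-* q↦z (U↦u (suc n))) (U↦u n)
    difference-of-squares : ∀ z → (z + + 2) * (z - + 2) ≡ z * z - + 4
    difference-of-squares = solve-∀


odd-prime : ∀ {p} → Prime p → p ≢ 2 → p ≡ suc (p ℕ./ 2 ℕ.+ p ℕ./ 2)
odd-prime {p} p-prime p≢2 with p ℕ.% 2 | m%n<n p 2 | m≡m%n+[m/n]*n p 2
... | 0           | _              | p≡[p/2]*2   with prime⇒irreducible p-prime (ℕ∣.divides (p ℕ./ 2) p≡[p/2]*2)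
...   | inj₁ ()
...   | inj₂ 2≡p = contradiction (≡.sym 2≡p) p≢2
odd-prime {p} p-prime p≢2 | 1 | _ | p≡1+[p/2]*2 =
  ≡.trans p≡1+[p/2]*2 (≡.cong suc (≡.trans (ℕₚ.*-comm (p ℕ./ 2) 2) (≡.cong (p ℕ./ 2 ℕ.+_) (ℕₚ.+-identityʳ (p ℕ./ 2)))))
odd-prime {p} p-prime p≢2 | suc (suc _) | s≤s (s≤s ()) | _

open import Data.Rational using (_+_; _-_; _*_; _/_)

proposition7 : (q : ℚ) (p : ℕ) → Prime p → p ≢ 2 → ¬ (p ∈𝒟 q) →
    (C p q ≡ q [mod p ])
    × (V p q ≡ legendreℚ (q + (+ 2) / 1) p [mod p ])
    × (W p q ≡ legendreℚ (q - (+ 2) / 1) p [mod p ])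
    × (U p q ≡ legendreℚ (q * q - (+ 4) / 1) p [mod p ])
proposition7 q p p-prime p≢2 p∉𝒟q =
  ≡.subst (ChebyshevCongruences q k) (≡.sym p≡1+2k)
    (OddPrime.chebyshev-congruences k (≡.subst Prime p≡1+2k p-prime) q (≡.subst (λ n → ¬ (n ∈𝒟 q)) p≡1+2k p∉𝒟q))
  where
  k : ℕ
  k = p ℕ./ 2
  p≡1+2k : p ≡ suc (k ℕ.+ k)
  p≡1+2k = odd-prime p-prime p≢2
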